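{- Let $R=\{5,7,10,11,14,15,17,19,20,21,22\}$ (the integers $r$ with $0<r<23$ and Legendre symbol $\left(\frac{r}{23}\right)=-1$). Let $p$ be a prime with $p=23k+r$ for some nonnegative integer $k$ and some $r\in R$. Then the set $T(p)$ is nonempty.
   Context: For a prime $p$, $S(p)$ is the set of $j$ with $0\le j\le p-1$ such that $j\equiv m(3m-1)/2\pmod p$ for some integer $m$, and $T(p)$ is the set of $k$ with $0\le k\le p-1$ such that $k$ is larger than every element of $S(p)$. -}

module Defs where

open import Data.Nat as ℕ using (ℕ; _<_)
open import Data.Nat.Primality using (Prime)
open import Data.Integer as ℤ using (ℤ; +_)
open import Data.Integer.DivMod using (_/_)
open import Data.Integer.Divisibility using (_∣_)
open import Data.Product using (∃; _×_)
open import Data.List using (List; _∷_; [])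
open import Data.List.Membership.Propositional using (_∈_)

-- the (generalised) pentagonal number m(3m-1)/2, for integer m
-- (m(3m-1) is always even, so the division is exact)
pent : ℤ → ℤ
pent m = (m ℤ.* (+ 3 ℤ.* m ℤ.- + 1)) / + 2

InS : ℕ → ℕ → Set
InS p j = j < p × ∃ λ (m : ℤ) → (+ p) ∣ (+ j ℤ.- pent m)

InT : ℕ → ℕ → Set
InT p k = k < p × (∀ j → InS p j → j < k)

R : List ℕ
R = 5 ∷ 7 ∷ 10 ∷ 11 ∷ 14 ∷ 15 ∷ 17 ∷ 19 ∷ 20 ∷ 21 ∷ 22 ∷ []

{-# OPTIONS --safe #-}
-- If p - 1 ≡ m(3m-1)/2 (mod p), then (6m-1)² + 23 = 24 (m(3m-1)/2 + 1) is divisible by 4p, so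
-- p x² + (6m-1) x y + c y² is a form of discriminant -23 representing p. Reducing it to
-- |b| ≤ a ≤ c forces 3a² ≤ 23, i.e. a ∈ {1, 2}, and completing the square gives 4ap = z² + 23 y².
-- Thus 4p or 8p is a square mod 23; but for p ≡ r ∈ R both 4r and 8r are non-residues.
-- Hence p - 1 ∉ S(p), and p - 1 ∈ T(p).
module Submission where

open import Defs
open import Data.Nat.Base as ℕ using (ℕ; zero; suc; s≤s; z<s; NonZero)
import Data.Nat.Properties as ℕ
open import Data.Nat.Induction using (<-wellFounded)
open import Data.Nat.Primality using (Prime)
open import Data.Fin.Base using (Fin; toℕ; fromℕ<)
open import Data.Fin.Properties using (any?; toℕ-fromℕ<)
open import Data.Product.Base using (∃; ∃₂; _×_; _,_; proj₁; proj₂; uncurry)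
open import Data.Sum.Base using (_⊎_; inj₁; inj₂)
open import Data.List.Base using (_∷_; [])
open import Data.List.Membership.Propositional using (_∈_)
open import Data.List.Relation.Unary.All using (All; all?; lookup)
open import Function.Base using (_∘_)
open import Induction.WellFounded using (Acc; acc)
open import Relation.Nullary.Decidable using (Dec; yes; no; map′; ¬?; _×-dec_; toWitness)
open import Relation.Nullary.Negation using (¬_; contradiction)
open import Relation.Binary.PropositionalEquality

module _ where
  open import Data.Integer.Base using (ℤ; +_; -[1+_]; _+_; _-_; -_; _*_; ∣_∣; _/_; _%_; _/ℕ_; _%ℕ_)
  import Data.Integer.Base as ℤ
  open import Data.Integer.Properties
    using (+-identityˡ; pos-*; +-injective; +◃n≡+n; [+m]-[+n]≡m⊖n; ∣⊖∣-<)
  open import Data.Integer.DivMod using (a≡a%n+[a/n]*n; n%d<d; a≡a%ℕn+[a/ℕn]*n; n%ℕd<d)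
  open import Data.Integer.Divisibility.Signed
    using (_∣_; divides; ∣-refl; ∣⇒∣ᵤ; ∣ᵤ⇒∣; ∣m+n∣n⇒∣m; ∣m∣n⇒∣m-n; ∣m⇒∣m*n; ∣n⇒∣m*n)
  open import Data.Nat.DivMod using (m<n⇒m%n≡m)
  open import Data.Nat.Divisibility using (n∣m⇒m%n≡0)
  open import Data.Integer.Tactic.RingSolver using (solve; solve-∀)

  i/j*j≡i : ∀ {i} j .{{_ : ℤ.NonZero j}} → j ∣ i → i / j * j ≡ i
  i/j*j≡i {i} j j∣i = begin
    i / j * j              ≡⟨ +-identityˡ (i / j * j) ⟨
    + 0 + i / j * j        ≡⟨ cong (λ r → + r + i / j * j) remainder≡0 ⟨
    + (i % j) + i / j * j  ≡⟨ a≡a%n+[a/n]*n i j ⟨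
    i                      ∎
    where
    open ≡-Reasoning
    j∣remainder : j ∣ + (i % j)
    j∣remainder = ∣m+n∣n⇒∣m (subst (j ∣_) (a≡a%n+[a/n]*n i j) j∣i) (∣n⇒∣m*n (i / j) ∣-refl)
    remainder≡0 : i % j ≡ 0
    remainder≡0 = trans (sym (m<n⇒m%n≡m (n%d<d i j))) (n∣m⇒m%n≡0 _ _ (∣⇒∣ᵤ j∣remainder))

  2∣m[3m-1] : ∀ m → + 2 ∣ m * (+ 3 * m - + 1)
  2∣m[3m-1] m with m %ℕ 2 | n%ℕd<d m 2 | m /ℕ 2 | a≡a%ℕn+[a/ℕn]*n m 2
  ... | 0 | _ | q | m≡2q = ∣m⇒∣m*n (+ 3 * m - + 1) (divides q (trans m≡2q (+-identityˡ _)))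
  ... | 1 | _ | q | m≡2q+1 = ∣n⇒∣m*n m (divides (+ 1 + + 3 * q) (begin
    + 3 * m - + 1                ≡⟨ cong (λ x → + 3 * x - + 1) m≡2q+1 ⟩
    + 3 * (+ 1 + q * + 2) - + 1  ≡⟨ solve (q ∷ []) ⟩
    (+ 1 + + 3 * q) * + 2        ∎))
    where open ≡-Reasoning
  ... | suc (suc _) | s≤s (s≤s ()) | _ | _

  pentagonal-discriminant : ∀ m → (+ 6 * m - + 1) * (+ 6 * m - + 1) + + 23 ≡ + 24 * (pent m + + 1)
  pentagonal-discriminant m with pent m | i/j*j≡i (+ 2) (2∣m[3m-1] m)
  ... | P | P*2≡m[3m-1] = begin
    (+ 6 * m - + 1) * (+ 6 * m - + 1) + + 23  ≡⟨ solve (m ∷ []) ⟩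
    + 12 * (m * (+ 3 * m - + 1)) + + 24       ≡⟨ cong (λ x → + 12 * x + + 24) P*2≡m[3m-1] ⟨
    + 12 * (P * + 2) + + 24                   ≡⟨ solve (P ∷ []) ⟩
    + 24 * (P + + 1)                          ∎
    where open ≡-Reasoning

  i*i≡+∣i∣*∣i∣ : ∀ i → i * i ≡ + (∣ i ∣ ℕ.* ∣ i ∣)
  i*i≡+∣i∣*∣i∣ (+ n)    = +◃n≡+n (n ℕ.* n)
  i*i≡+∣i∣*∣i∣ -[1+ n ] = +◃n≡+n (suc n ℕ.* suc n)

  module BinaryQuadraticForms (D : ℤ) where

    record HasDiscriminant (a b c : ℤ) : Set where
      constructor has-discriminant
      field b²+D≡4ac : b * b + D ≡ + 4 * a * c

    record Represents (a b c n : ℤ) : Set where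
      constructor represents
      field
        x y : ℤ
        value : a * x * x + b * x * y + c * y * y ≡ n

    represents-first-coefficient : ∀ a b c → Represents a b c a
    represents-first-coefficient a b c = represents (+ 1) (+ 0) (solve (a ∷ b ∷ c ∷ []))

    translate-discriminant : ∀ {a b c} t → HasDiscriminant a b c →
                             HasDiscriminant a (b + + 2 * a * t) (a * t * t + b * t + c)
    translate-discriminant {a} {b} {c} t (has-discriminant disc) = has-discriminant (begin
      (b + + 2 * a * t) * (b + + 2 * a * t) + D    ≡⟨ solve (a ∷ b ∷ t ∷ D ∷ []) ⟩
      (b * b + D) + + 4 * a * (a * t * t + b * t)  ≡⟨ cong (_+ + 4 * a * (a * t * t + b * t)) disc ⟩
      + 4 * a * c + + 4 * a * (a * t * t + b * t)  ≡⟨ solve (a ∷ b ∷ c ∷ t ∷ []) ⟩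
      + 4 * a * (a * t * t + b * t + c)            ∎)
      where open ≡-Reasoning

    translate-represents : ∀ {a b c n} t → Represents a b c n →
                           Represents a (b + + 2 * a * t) (a * t * t + b * t + c) n
    translate-represents {a} {b} {c} {n} t (represents x y rep) = represents (x - t * y) y (begin
      a * (x - t * y) * (x - t * y) + (b + + 2 * a * t) * (x - t * y) * y + (a * t * t + b * t + c) * y * y
        ≡⟨ solve (a ∷ b ∷ c ∷ t ∷ x ∷ y ∷ []) ⟩
      a * x * x + b * x * y + c * y * y
        ≡⟨ rep ⟩
      n ∎)
      where open ≡-Reasoning

    swap-discriminant : ∀ {a b c} → HasDiscriminant a b c → HasDiscriminant c (- b) a
    swap-discriminant {a} {b} {c} (has-discriminant disc) = has-discriminant (begin
      - b * - b + D  ≡⟨ solve (b ∷ D ∷ []) ⟩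
      b * b + D      ≡⟨ disc ⟩
      + 4 * a * c    ≡⟨ solve (a ∷ c ∷ []) ⟩
      + 4 * c * a    ∎)
      where open ≡-Reasoning

    swap-represents : ∀ {a b c n} → Represents a b c n → Represents c (- b) a n
    swap-represents {a} {b} {c} {n} (represents x y rep) = represents y (- x) (begin
      c * y * y + - b * y * - x + a * - x * - x  ≡⟨ solve (a ∷ b ∷ c ∷ x ∷ y ∷ []) ⟩
      a * x * x + b * x * y + c * y * y          ≡⟨ rep ⟩
      n                                          ∎)
      where open ≡-Reasoning

    complete-square : ∀ {a b c n} → HasDiscriminant a b c → Represents a b c n →
                      ∃₂ λ z y → + 4 * a * n ≡ z * z + D * (y * y)
    complete-square {a} {b} {c} {n} (has-discriminant disc) (represents x y rep) = + 2 * a * x + b * y , y , (begin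
      + 4 * a * n
        ≡⟨ cong (+ 4 * a *_) rep ⟨
      + 4 * a * (a * x * x + b * x * y + c * y * y)
        ≡⟨ solve (a ∷ b ∷ c ∷ x ∷ y ∷ []) ⟩
      (+ 2 * a * x + b * y) * (+ 2 * a * x + b * y) + + 4 * a * c * (y * y) - b * b * (y * y)
        ≡⟨ cong (λ e → (+ 2 * a * x + b * y) * (+ 2 * a * x + b * y) + e * (y * y) - b * b * (y * y)) disc ⟨
      (+ 2 * a * x + b * y) * (+ 2 * a * x + b * y) + (b * b + D) * (y * y) - b * b * (y * y)
        ≡⟨ solve (a ∷ b ∷ x ∷ y ∷ D ∷ []) ⟩
      (+ 2 * a * x + b * y) * (+ 2 * a * x + b * y) + D * (y * y)
        ∎)
      where open ≡-Reasoning

  centre-remainder : ∀ {a ρ b} q → ρ ℕ.< 2 ℕ.* a → b ≡ + ρ + q * (+ 2 * + a) →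
                     ∃ λ t → ∣ b + + 2 * + a * t ∣ ℕ.≤ a
  centre-remainder {a} {ρ} {b} q ρ<2a b≡ρ+2aq with ρ ℕ.≤? a
  ... | yes ρ≤a = - q , subst (ℕ._≤ a) (cong ∣_∣ (sym b-2aq≡ρ)) ρ≤a
    where
    b-2aq≡ρ : b + + 2 * + a * - q ≡ + ρ
    b-2aq≡ρ = trans (cong (_+ + 2 * + a * - q) b≡ρ+2aq) (r+2Aq-2Aq≡r (+ ρ) q (+ a))
      where
      r+2Aq-2Aq≡r : ∀ r q A → r + q * (+ 2 * A) + + 2 * A * - q ≡ r
      r+2Aq-2Aq≡r = solve-∀
  ... | no ρ≰a = - q - + 1 , subst (ℕ._≤ a) (sym ∣b-2a[q+1]∣≡2a∸ρ) (ℕ.m≤n+o⇒m∸n≤o (2 ℕ.* a) ρ 2a≤ρ+a)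
    where
    b-2a[q+1]≡ρ-2a : b + + 2 * + a * (- q - + 1) ≡ + ρ - + (2 ℕ.* a)
    b-2a[q+1]≡ρ-2a = begin
      b + + 2 * + a * (- q - + 1)                          ≡⟨ cong (_+ + 2 * + a * (- q - + 1)) b≡ρ+2aq ⟩
      + ρ + q * (+ 2 * + a) + + 2 * + a * (- q - + 1)      ≡⟨ r+2Aq-2A[q+1]≡r-2A (+ ρ) q (+ a) ⟩
      + ρ - + 2 * + a                                      ≡⟨ cong (λ A → + ρ - A) (pos-* 2 a) ⟨
      + ρ - + (2 ℕ.* a)                                    ∎
      where
      open ≡-Reasoning
      r+2Aq-2A[q+1]≡r-2A : ∀ r q A → r + q * (+ 2 * A) + + 2 * A * (- q - + 1) ≡ r - + 2 * A
      r+2Aq-2A[q+1]≡r-2A = solve-∀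
    ∣b-2a[q+1]∣≡2a∸ρ : ∣ b + + 2 * + a * (- q - + 1) ∣ ≡ 2 ℕ.* a ℕ.∸ ρ
    ∣b-2a[q+1]∣≡2a∸ρ = trans (cong ∣_∣ (trans b-2a[q+1]≡ρ-2a ([+m]-[+n]≡m⊖n ρ (2 ℕ.* a)))) (∣⊖∣-< ρ<2a)
    2a≤ρ+a : 2 ℕ.* a ℕ.≤ ρ ℕ.+ a
    2a≤ρ+a = subst (ℕ._≤ ρ ℕ.+ a) (cong (a ℕ.+_) (sym (ℕ.+-identityʳ a))) (ℕ.+-monoˡ-≤ a (ℕ.<⇒≤ (ℕ.≰⇒> ρ≰a)))

  centre : ∀ a .{{_ : NonZero a}} b → ∃ λ t → ∣ b + + 2 * + a * t ∣ ℕ.≤ a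
  centre a b = centre-remainder q (n%ℕd<d b (2 ℕ.* a))
    (trans (a≡a%ℕn+[a/ℕn]*n b (2 ℕ.* a)) (cong (λ A → + (b %ℕ (2 ℕ.* a)) + q * A) (pos-* 2 a)))
    where
    instance
      2a≢0 : NonZero (2 ℕ.* a)
      2a≢0 = ℕ.m*n≢0 2 a
    q : ℤ
    q = b /ℕ (2 ℕ.* a)

  module PositiveDefiniteForms (D : ℕ) where
    open BinaryQuadraticForms (+ D) public

    discriminant-ℕ : ∀ {a b c} → HasDiscriminant (+ a) b (+ c) → ∣ b ∣ ℕ.* ∣ b ∣ ℕ.+ D ≡ 4 ℕ.* a ℕ.* c
    discriminant-ℕ {a} {b} {c} (has-discriminant disc) = +-injective (begin
      + (∣ b ∣ ℕ.* ∣ b ∣) + + D  ≡⟨ cong (_+ + D) (i*i≡+∣i∣*∣i∣ b) ⟨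
      b * b + + D                ≡⟨ disc ⟩
      + 4 * + a * + c            ≡⟨ cong (_* + c) (pos-* 4 a) ⟨
      + (4 ℕ.* a) * + c          ≡⟨ pos-* (4 ℕ.* a) c ⟨
      + (4 ℕ.* a ℕ.* c)          ∎)
      where open ≡-Reasoning

    positive-coefficient : ∀ {a b c} .{{_ : NonZero D}} → 0 ℕ.< a → HasDiscriminant (+ a) b c →
                           ∃ λ γ → 0 ℕ.< γ × c ≡ + γ
    positive-coefficient {c = + suc γ} _ _ = suc γ , z<s , refl
    positive-coefficient {a} {c = + zero} _ disc =
      contradiction (ℕ.m+n≡0⇒n≡0 _ (trans (discriminant-ℕ disc) (ℕ.*-zeroʳ (4 ℕ.* a)))) (ℕ.≢-nonZero⁻¹ D)
    positive-coefficient {b = b} {c = -[1+ _ ]} z<s (has-discriminant disc)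
      with trans (cong (_+ + D) (sym (i*i≡+∣i∣*∣i∣ b))) disc
    ... | ()

    CentredRepresentation : ℕ → ℤ → Set
    CentredRepresentation a n =
      ∃₂ λ b γ → ∣ b ∣ ℕ.≤ a × 0 ℕ.< γ × HasDiscriminant (+ a) b (+ γ) × Represents (+ a) b (+ γ) n

    centre-form : ∀ {a b c n} .{{_ : NonZero D}} → 0 ℕ.< a →
                  HasDiscriminant (+ a) b c → Represents (+ a) b c n → CentredRepresentation a n
    centre-form {a} {b} 0<a disc rep with centre a {{ℕ.>-nonZero 0<a}} b
    ... | t , ∣b′∣≤a with positive-coefficient 0<a (translate-discriminant t disc)
    ...   | γ , 0<γ , c′≡γ = _ , γ , ∣b′∣≤a , 0<γ ,
            subst (HasDiscriminant (+ a) _) c′≡γ (translate-discriminant t disc) ,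
            subst (λ c → Represents (+ a) _ c _) c′≡γ (translate-represents t rep)

    data ReducedRepresentation (n : ℤ) : Set where
      reduced : ∀ {a b c} → 0 ℕ.< a → ∣ b ∣ ℕ.≤ a → a ℕ.≤ c →
                HasDiscriminant (+ a) b (+ c) → Represents (+ a) b (+ c) n → ReducedRepresentation n

    reduce-acc : ∀ {a b c n} .{{_ : NonZero D}} → Acc ℕ._<_ a → 0 ℕ.< a →
                 HasDiscriminant (+ a) b c → Represents (+ a) b c n → ReducedRepresentation n
    reduce-acc {a} {n = n} (acc smaller) 0<a disc rep = reduce-centred (centre-form 0<a disc rep)
      where
      reduce-centred : CentredRepresentation a n → ReducedRepresentation n
      reduce-centred (_ , γ , ∣b∣≤a , 0<γ , disc′ , rep′) with a ℕ.≤? γ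
      ... | yes a≤γ = reduced 0<a ∣b∣≤a a≤γ disc′ rep′
      ... | no a≰γ  = reduce-acc (smaller (ℕ.≰⇒> a≰γ)) 0<γ (swap-discriminant disc′) (swap-represents rep′)

    reduce : ∀ {a b c n} .{{_ : NonZero D}} → 0 ℕ.< a →
             HasDiscriminant (+ a) b c → Represents (+ a) b c n → ReducedRepresentation n
    reduce {a} = reduce-acc (<-wellFounded a)

    reduced-bound : ∀ {a b c} → ∣ b ∣ ℕ.≤ a → a ℕ.≤ c → HasDiscriminant (+ a) b (+ c) → 3 ℕ.* (a ℕ.* a) ℕ.≤ D
    reduced-bound {a} {b} {c} ∣b∣≤a a≤c disc = ℕ.+-cancelʳ-≤ (a ℕ.* a) _ _ (begin
      3 ℕ.* (a ℕ.* a) ℕ.+ a ℕ.* a  ≡⟨ ℕ.+-comm (3 ℕ.* (a ℕ.* a)) (a ℕ.* a) ⟩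
      4 ℕ.* (a ℕ.* a)              ≡⟨ ℕ.*-assoc 4 a a ⟨
      4 ℕ.* a ℕ.* a                ≤⟨ ℕ.*-monoʳ-≤ (4 ℕ.* a) a≤c ⟩
      4 ℕ.* a ℕ.* c                ≡⟨ discriminant-ℕ disc ⟨
      ∣ b ∣ ℕ.* ∣ b ∣ ℕ.+ D        ≤⟨ ℕ.+-monoˡ-≤ D (ℕ.*-mono-≤ ∣b∣≤a ∣b∣≤a) ⟩
      a ℕ.* a ℕ.+ D                ≡⟨ ℕ.+-comm (a ℕ.* a) D ⟩
      D ℕ.+ a ℕ.* a                ∎)
      where open ℕ.≤-Reasoning

    reduced-norm : ∀ {n} → ReducedRepresentation (+ n) →
                   ∃ λ a → 0 ℕ.< a × 3 ℕ.* (a ℕ.* a) ℕ.≤ D ×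
                   ∃₂ λ z y → 4 ℕ.* a ℕ.* n ≡ z ℕ.* z ℕ.+ D ℕ.* (y ℕ.* y)
    reduced-norm {n} (reduced {a} 0<a ∣b∣≤a a≤c disc rep) with complete-square disc rep
    ... | z , y , 4an≡z²+Dy² = a , 0<a , reduced-bound ∣b∣≤a a≤c disc , ∣ z ∣ , ∣ y ∣ , +-injective (begin
      + (4 ℕ.* a ℕ.* n)                        ≡⟨ pos-* (4 ℕ.* a) n ⟩
      + (4 ℕ.* a) * + n                        ≡⟨ cong (_* + n) (pos-* 4 a) ⟩
      + 4 * + a * + n                          ≡⟨ 4an≡z²+Dy² ⟩
      z * z + + D * (y * y)                    ≡⟨ cong₂ (λ u v → u + + D * v) (i*i≡+∣i∣*∣i∣ z) (i*i≡+∣i∣*∣i∣ y) ⟩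
      + (∣ z ∣ ℕ.* ∣ z ∣) + + D * + (∣ y ∣ ℕ.* ∣ y ∣)  ≡⟨ cong (_+_ (+ (∣ z ∣ ℕ.* ∣ z ∣))) (pos-* D (∣ y ∣ ℕ.* ∣ y ∣)) ⟨
      + (∣ z ∣ ℕ.* ∣ z ∣ ℕ.+ D ℕ.* (∣ y ∣ ℕ.* ∣ y ∣))   ∎)
      where open ≡-Reasoning

  open PositiveDefiniteForms 23
    using (HasDiscriminant; has-discriminant; represents-first-coefficient; ReducedRepresentation; reduce)

  -- Stated for the modulus + 1 + J, which is + suc j by computation, so that J is a ring variable.
  pentagonal⇒discriminant-23 : ∀ {J m} → + 1 + J ∣ J - pent m →
    ∃ λ c → HasDiscriminant (+ 1 + J) (+ 6 * m - + 1) c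
  pentagonal⇒discriminant-23 {J} {m} N∣J-P with ∣m∣n⇒∣m-n (∣-refl {+ 1 + J}) N∣J-P
  ... | divides s N-[J-P]≡sN = + 6 * s , has-discriminant (begin
    (+ 6 * m - + 1) * (+ 6 * m - + 1) + + 23  ≡⟨ pentagonal-discriminant m ⟩
    + 24 * (pent m + + 1)                     ≡⟨ cong (+ 24 *_) (P+1≡[1+J]-[J-P] J (pent m)) ⟩
    + 24 * ((+ 1 + J) - (J - pent m))         ≡⟨ cong (+ 24 *_) N-[J-P]≡sN ⟩
    + 24 * (s * (+ 1 + J))                    ≡⟨ solve (s ∷ J ∷ []) ⟩
    + 4 * (+ 1 + J) * (+ 6 * s)               ∎)
    where
    open ≡-Reasoning
    P+1≡[1+J]-[J-P] : ∀ J P → P + + 1 ≡ (+ 1 + J) - (J - P)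
    P+1≡[1+J]-[J-P] = solve-∀

  last-pentagonal⇒reduced-representation : ∀ {j} → InS (suc j) j → ReducedRepresentation (+ suc j)
  last-pentagonal⇒reduced-representation {j} (_ , m , n∣j-P) =
    reduce z<s (proj₂ (pentagonal⇒discriminant-23 {+ j} {m} (∣ᵤ⇒∣ {+ suc j} {+ j - pent m} n∣j-P)))
           (represents-first-coefficient _ _ _)

open import Data.Nat.Base using (_+_; _*_; _%_; _≤_; _<_)
open import Data.Nat.DivMod using (%-distribˡ-*; %-remove-+ʳ; [m+kn]%n≡m%n; m%n<n)
open import Data.Nat.Divisibility using (m∣m*n)
open import Data.Nat.Tactic.RingSolver using (solve)
open import Data.Integer.Base using (+_)
open PositiveDefiniteForms 23 using (ReducedRepresentation; reduced-norm)

IsSquareMod : (m : ℕ) .{{_ : NonZero m}} → ℕ → Set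
IsSquareMod m x = ∃ λ z → z * z % m ≡ x % m

isSquareMod? : ∀ m .{{_ : NonZero m}} x → Dec (IsSquareMod m x)
isSquareMod? m x = map′ (λ (i , i²≡x) → toℕ i , i²≡x) root-below-m (any? λ i → toℕ i * toℕ i % m ℕ.≟ x % m)
  where
  root-below-m : IsSquareMod m x → ∃ λ (i : Fin m) → toℕ i * toℕ i % m ≡ x % m
  root-below-m (z , z²≡x) = fromℕ< (m%n<n z m) , (begin
    toℕ (fromℕ< (m%n<n z m)) * toℕ (fromℕ< (m%n<n z m)) % m  ≡⟨ cong (λ r → r * r % m) (toℕ-fromℕ< (m%n<n z m)) ⟩
    z % m * (z % m) % m                                       ≡⟨ %-distribˡ-* z z m ⟨
    z * z % m                                                 ≡⟨ z²≡x ⟩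
    x % m                                                     ∎)
    where open ≡-Reasoning

norm⇒IsSquareMod : ∀ {m N} .{{_ : NonZero m}} z y → N ≡ z * z + m * (y * y) → IsSquareMod m N
norm⇒IsSquareMod {m} z y N≡z²+my² = z , sym (trans (cong (_% m) N≡z²+my²) (%-remove-+ʳ (z * z) (m∣m*n (y * y))))

IsSquareMod-shift : ∀ c m k r .{{_ : NonZero m}} → IsSquareMod m (c * (m * k + r)) → IsSquareMod m (c * r)
IsSquareMod-shift c m k r (z , z²≡c[mk+r]) =
  z , trans z²≡c[mk+r] (trans (cong (_% m) expand) ([m+kn]%n≡m%n (c * r) (c * k) m))
  where
  expand : c * (m * k + r) ≡ c * r + c * k * m
  expand = solve (c ∷ m ∷ k ∷ r ∷ [])

small-coefficient : ∀ {a} → 0 < a → 3 * (a * a) ≤ 23 → a ≡ 1 ⊎ a ≡ 2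
small-coefficient {1} _ _ = inj₁ refl
small-coefficient {2} _ _ = inj₂ refl
small-coefficient {a@(suc (suc (suc _)))} _ 3a²≤23 = contradiction 23<3a² (ℕ.≤⇒≯ 3a²≤23)
  where
  3≤a : 3 ≤ a
  3≤a = s≤s (s≤s (s≤s ℕ.z≤n))
  23<3a² : 23 < 3 * (a * a)
  23<3a² = ℕ.≤-trans (ℕ.m≤n+m 24 3) (ℕ.*-monoʳ-≤ 3 (ℕ.*-mono-≤ 3≤a 3≤a))

no-reduced-representation : ∀ {n} → ¬ IsSquareMod 23 (4 * n) → ¬ IsSquareMod 23 (8 * n) →
                            ¬ ReducedRepresentation (+ n)
no-reduced-representation ¬□4n ¬□8n rr with reduced-norm rr
... | a , 0<a , 3a²≤23 , z , y , 4an≡z²+23y² with small-coefficient 0<a 3a²≤23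
...   | inj₁ refl = ¬□4n (norm⇒IsSquareMod z y 4an≡z²+23y²)
...   | inj₂ refl = ¬□8n (norm⇒IsSquareMod z y 4an≡z²+23y²)

last-element-in-T : ∀ {n} → ¬ IsSquareMod 23 (4 * n) → ¬ IsSquareMod 23 (8 * n) → ∃ λ t → InT n t
last-element-in-T {zero} ¬□0 _ = contradiction (0 , refl) ¬□0
last-element-in-T {suc j} ¬□4n ¬□8n = j , ℕ.n<1+n j , below-j
  where
  below-j : ∀ i → InS (suc j) i → i < j
  below-j i i∈S = ℕ.≤∧≢⇒< (ℕ.s≤s⁻¹ (proj₁ i∈S)) λ i≡j →
    no-reduced-representation ¬□4n ¬□8n (last-pentagonal⇒reduced-representation (subst (InS (suc j)) i≡j i∈S))

R-non-squares : All (λ r → ¬ IsSquareMod 23 (4 * r) × ¬ IsSquareMod 23 (8 * r)) R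
R-non-squares = toWitness {a? = all? (λ r → ¬? (isSquareMod? 23 (4 * r)) ×-dec ¬? (isSquareMod? 23 (8 * r))) R} _

non-squares : ∀ {n} k {r} → r ∈ R → n ≡ 23 * k + r → ¬ IsSquareMod 23 (4 * n) × ¬ IsSquareMod 23 (8 * n)
non-squares k {r} r∈R refl =
  let ¬□4r , ¬□8r = lookup R-non-squares r∈R
  in ¬□4r ∘ IsSquareMod-shift 4 23 k r , ¬□8r ∘ IsSquareMod-shift 8 23 k r

theorem2 : (p k r : ℕ) → Prime p → r ∈ R → p ≡ 23 * k + r →
    ∃ λ t → InT p t
theorem2 p k r _ r∈R p≡23k+r = uncurry last-element-in-T (non-squares k r∈R p≡23k+r)
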